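{- Let $U$ be an $n$-point set with a hidden $k$-clustering and for $x\in U$ let $C(x)$ denote the cluster containing $x$. There is a deterministic non-adaptive algorithm $\mathsf{FINDREP}$ which takes as input a point $x\in U$ and a set $R\subseteq U$, makes $4\lceil\log|R|\rceil$ subset queries, and correctly certifies whether $|R\cap C(x)|=1$ or $|R\cap C(x)|\neq 1$; moreover, if $|R\cap C(x)|=1$, it outputs the unique element of $R\cap C(x)$.
   Context: A $k$-clustering of $U$ is a hidden partition $U=C_1\sqcup\cdots\sqcup C_k$. A subset query on $S\subseteq U$ returns $\mathsf{count}(S)=|\{i\in[k]: C_i\cap S\neq\emptyset\}|$. Non-adaptive means the queries are fixed before any answer is seen. Logarithms are base 2. -}

module Defs where

open import Data.Nat using (ℕ; _*_; _≤_)
open import Data.Bool using (Bool; _∧_)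
open import Data.Fin using (Fin; _≟_)
open import Data.Fin.Subset using (Subset; ∣_∣; _∩_; _∈_)
open import Data.Vec using (tabulate; lookup)
open import Data.List using (List; map; length; allFin)
open import Data.Bool.ListAction using (any)
open import Data.Maybe using (Maybe; just; nothing)
open import Data.Product using (Σ; _×_)
open import Function.Definitions using (Surjective)
open import Relation.Binary.PropositionalEquality using (_≡_; _≢_)
open import Relation.Nullary.Decidable using (⌊_⌋)
open import Data.Nat.Logarithm using (⌈log₂_⌉)

-- A k-clustering of U = Fin n: a labelling of points by cluster index,
-- cluster C_i = { u | c u ≡ i }.  A partition has nonempty parts, so the
-- labelling is required to be surjective.
Labelling : ℕ → ℕ → Set
Labelling n k = Fin n → Fin k

IsClustering : ∀ {n k} → Labelling n k → Set
IsClustering c = Surjective _≡_ _≡_ c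

hitClusters : ∀ {n k} → Labelling n k → Subset n → Subset k
hitClusters {n} c S =
  tabulate (λ i → any (λ u → lookup S u ∧ ⌊ c u ≟ i ⌋) (allFin n))

count : ∀ {n k} → Labelling n k → Subset n → ℕ
count c S = ∣ hitClusters c S ∣

clusterOf : ∀ {n k} → Labelling n k → Fin n → Subset n
clusterOf c x = tabulate (λ u → ⌊ c u ≟ c x ⌋)

-- A deterministic non-adaptive algorithm taking input (x , R):
-- the list of queries depends only on the input (x , R), never on answers
-- or the hidden clustering; the output is computed from the answers.
-- Output `just r` means "|R ∩ C(x)| = 1, and r is its element";
-- output `nothing` means "|R ∩ C(x)| ≠ 1".
record NonAdaptiveAlg (n : ℕ) : Set where
  field
    queries : Fin n → Subset n → List (Subset n)
    decide  : Fin n → Subset n → List ℕ → Maybe (Fin n)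

open NonAdaptiveAlg public

run : ∀ {n k} → NonAdaptiveAlg n → Labelling n k → Fin n → Subset n → Maybe (Fin n)
run A c x R = decide A x R (map (count c) (queries A x R))

FindRepCorrect : ∀ {n k} → NonAdaptiveAlg n → Labelling n k → Fin n → Subset n → Set
FindRepCorrect {n} A c x R =
  (∣ R ∩ clusterOf c x ∣ ≡ 1 →
     Σ (Fin n) (λ r → (run A c x R ≡ just r) × (r ∈ R ∩ clusterOf c x)))
  × (∣ R ∩ clusterOf c x ∣ ≢ 1 → run A c x R ≡ nothing)

{-# OPTIONS --safe #-}
module Submission where

-- Give the points of R distinct binary codes of length ⌈log₂ ∣R∣⌉ (through their rank in R) and let
-- S(j,β) be the points of R whose j-th bit is β.  The answers count(S) and count(S ∪ {x}) agree
-- exactly when S meets C(x), so the 4⌈log₂ ∣R∣⌉ answers tell which of the sets S(j,β) meet C(x).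
-- A point u ∈ R is output when it lies in exactly those S(j,β) that meet C(x).  If R ∩ C(x) = {r},
-- then r qualifies.  Conversely, if u qualifies, then some S(j,β) containing u meets C(x), so
-- R ∩ C(x) is nonempty; and each of its points lies only in sets S(j,β) that contain u, so it has
-- the code of u and is u.

open import Defs
open import Data.Bool as Bool using (Bool; T; _∧_)
open import Data.Bool.ListAction using (any)
open import Data.Bool.Properties using (T-≡; T-∧)
open import Data.Fin as Fin using (Fin; _≟_; fromℕ<; toℕ)
open import Data.Fin.Patterns using (0F; 1F)
open import Data.Fin.Properties using (any?; toℕ-fromℕ<)
open import Data.Fin.Subset using (Subset; ∣_∣; _∈_; _∉_; _⊆_; _∩_; _∪_; ⁅_⁆; ⊥; inside; outside)
open import Data.Fin.Subset.Properties
  using (_∈?_; ⊆-antisym; p⊆p∪q; q⊆p∪q; x∈p∪q⁺; x∈p∪q⁻; x∈p∩q⁺; x∈p∩q⁻; p∩q⊆p;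
         x∈⁅x⁆; x∈⁅y⁆⇒x≡y; x∈⁅y⁆⇔x≡y; ∣⁅x⁆∣≡1; p⊂q⇒∣p∣<∣q∣)
open import Data.List using (List; []; _∷_; map; length; allFin)
open import Data.List.Properties
  using (map-cong-local; length-tabulate; ∷-injectiveˡ; ∷-injectiveʳ; ≡-dec)
open import Data.List.Membership.Propositional using (lose) renaming (_∈_ to _∈ₗ_)
open import Data.List.Membership.Propositional.Properties using (∈-allFin)
open import Data.List.Relation.Unary.All as All using ()
open import Data.List.Relation.Unary.Any using (here; there; satisfied)
open import Data.List.Relation.Unary.Any.Properties using (any⁺; any⁻)
open import Data.Maybe as Maybe using (Maybe; just; nothing)
open import Data.Nat as ℕ using (ℕ; suc; zero; _+_; _*_; _≤_; _<_; _^_; z≤n; s≤s; ⌈_/2⌉; ⌊_/2⌋; NonZero)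
open import Data.Nat.DivMod using (_/_; _%_; _mod_; m≡m%n+[m/n]*n; m<n*o⇒m/o<n; m%n<n)
open import Data.Nat.Induction using (<-wellFounded)
open import Data.Nat.Logarithm using (⌈log₂_⌉; ⌈log₂⌉-mono-≤)
open import Data.Nat.Logarithm.Core using (⌈log2⌉)
open import Data.Nat.Properties
  using (≤-refl; ≤-trans; <-≤-trans; <-irrefl; suc-injective; *-suc; *-comm; *-assoc; *-monoʳ-≤;
         +-monoˡ-≤; +-identityʳ; ⌊n/2⌋+⌈n/2⌉≡n; ⌊n/2⌋≤⌈n/2⌉; ⌈n/2⌉<n; module ≤-Reasoning)
open import Data.Product using (Σ; _×_; ∃; _,_; proj₁; proj₂)
open import Data.Sum as Sum using (inj₁; inj₂; [_,_]′)
open import Data.Vec as Vec using (Vec; []; _∷_; lookup; tabulate)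
open import Data.Vec.Properties using (lookup∘tabulate; []=⇒lookup; lookup⇒[]=)
open import Function using (id; _∘_)
open import Function.Bundles using (_⇔_; mk⇔; Equivalence)
open import Function.Properties.Equivalence using () renaming (trans to ⇔-trans)
open import Induction.WellFounded using (Acc; acc)
open import Relation.Binary.PropositionalEquality
  using (_≡_; _≢_; refl; sym; trans; cong; cong₂; subst; _≗_; module ≡-Reasoning)
open import Relation.Nullary using (Dec; yes; no; does; contradiction; _×-dec_)
open import Relation.Nullary.Decidable as Dec
  using (⌊_⌋; toWitness; fromWitness; does-⇔; decidable-stable; dec⇒maybe)
open import Relation.Unary using (Pred; Decidable)

open Equivalence using (to; from)

private
  variable
    n k b : ℕ
    u v x : Fin n
    p R S : Subset n

∈⇔T-lookup : ∀ p → u ∈ p ⇔ T (lookup p u)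
∈⇔T-lookup {u = u} p = mk⇔ (from T-≡ ∘ []=⇒lookup) (lookup⇒[]= u p ∘ to T-≡)

∈-tabulate : ∀ (f : Fin n → Bool) → u ∈ tabulate f ⇔ T (f u)
∈-tabulate {u = u} f = subst (λ β → u ∈ tabulate f ⇔ T β) (lookup∘tabulate f u) (∈⇔T-lookup (tabulate f))

∣p∣≡0⇒p≡⊥ : ∣ p ∣ ≡ 0 → p ≡ ⊥
∣p∣≡0⇒p≡⊥ {p = []}          _  = refl
∣p∣≡0⇒p≡⊥ {p = outside ∷ p} eq = cong (outside ∷_) (∣p∣≡0⇒p≡⊥ eq)

∣p∣≡1⇒p≡⁅x⁆ : ∣ p ∣ ≡ 1 → ∃ λ x → p ≡ ⁅ x ⁆
∣p∣≡1⇒p≡⁅x⁆ {p = inside  ∷ p} eq = 0F , cong (inside ∷_) (∣p∣≡0⇒p≡⊥ (suc-injective eq))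
∣p∣≡1⇒p≡⁅x⁆ {p = outside ∷ p} eq with ∣p∣≡1⇒p≡⁅x⁆ eq
... | x , p≡⁅x⁆ = Fin.suc x , cong (outside ∷_) p≡⁅x⁆

x∈p⇒p∪⁅x⁆≡p : x ∈ p → p ∪ ⁅ x ⁆ ≡ p
x∈p⇒p∪⁅x⁆≡p {x = x} {p} x∈p = ⊆-antisym (λ y∈ → [ id , ⁅x⁆⊆p ]′ (x∈p∪q⁻ p ⁅ x ⁆ y∈)) (p⊆p∪q ⁅ x ⁆)
  where
  ⁅x⁆⊆p : ⁅ x ⁆ ⊆ p
  ⁅x⁆⊆p y∈⁅x⁆ = subst (_∈ p) (sym (x∈⁅y⁆⇒x≡y x y∈⁅x⁆)) x∈p

∣p∪⁅x⁆∣≡∣p∣⇔x∈p : ∣ p ∪ ⁅ x ⁆ ∣ ≡ ∣ p ∣ ⇔ x ∈ p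
∣p∪⁅x⁆∣≡∣p∣⇔x∈p {p = p} {x} = mk⇔ ∣p∪⁅x⁆∣≡∣p∣⇒x∈p (cong ∣_∣ ∘ x∈p⇒p∪⁅x⁆≡p)
  where
  x∉p⇒∣p∣<∣p∪⁅x⁆∣ : x ∉ p → ∣ p ∣ < ∣ p ∪ ⁅ x ⁆ ∣
  x∉p⇒∣p∣<∣p∪⁅x⁆∣ x∉p = p⊂q⇒∣p∣<∣q∣ (p⊆p∪q ⁅ x ⁆ , x , x∈p∪q⁺ (inj₂ (x∈⁅x⁆ x)) , x∉p)

  ∣p∪⁅x⁆∣≡∣p∣⇒x∈p : ∣ p ∪ ⁅ x ⁆ ∣ ≡ ∣ p ∣ → x ∈ p
  ∣p∪⁅x⁆∣≡∣p∣⇒x∈p eq = decidable-stable (x ∈? p) (λ x∉p → <-irrefl (sym eq) (x∉p⇒∣p∣<∣p∪⁅x⁆∣ x∉p))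

does-≡⇒⇔ : ∀ {a b} {A : Set a} {B : Set b} (a? : Dec A) (b? : Dec B) → does a? ≡ does b? → A ⇔ B
does-≡⇒⇔ (yes a) (yes b) _  = mk⇔ (λ _ → b) (λ _ → a)
does-≡⇒⇔ (no ¬a) (no ¬b) _  = mk⇔ (λ a → contradiction a ¬a) (λ b → contradiction b ¬b)

map-does-≡⇔ : ∀ {a p q} {A : Set a} {P : Pred A p} {Q : Pred A q}
              (P? : Decidable P) (Q? : Decidable Q) xs →
              map (does ∘ P?) xs ≡ map (does ∘ Q?) xs ⇔ (∀ {y} → y ∈ₗ xs → P y ⇔ Q y)
map-does-≡⇔ {P = P} {Q} P? Q? xs = mk⇔ (pointwise xs)
  (λ P⇔Q → map-cong-local (All.tabulate (λ y∈ → does-⇔ (P⇔Q y∈) (P? _) (Q? _))))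
  where
  pointwise : ∀ xs → map (does ∘ P?) xs ≡ map (does ∘ Q?) xs → ∀ {y} → y ∈ₗ xs → P y ⇔ Q y
  pointwise (y ∷ _)  eq (here refl) = does-≡⇒⇔ (P? y) (Q? y) (∷-injectiveˡ eq)
  pointwise (_ ∷ ys) eq (there y∈)  = pointwise ys (∷-injectiveʳ eq) y∈

module _ (c : Labelling n k) where

  ∈-clusterOf : ∀ x → u ∈ clusterOf c x ⇔ c u ≡ c x
  ∈-clusterOf x = mk⇔ (toWitness ∘ to (∈-tabulate _)) (from (∈-tabulate _) ∘ fromWitness)

  private
    hitsAt : Subset n → Fin k → Fin n → Bool
    hitsAt S i u = lookup S u ∧ ⌊ c u ≟ i ⌋

  ∈-hitClusters⁺ : ∀ S → u ∈ S → c u ∈ hitClusters c S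
  ∈-hitClusters⁺ {u = u} S u∈S = from (∈-tabulate (λ i → any (hitsAt S i) (allFin n)))
    (any⁺ (hitsAt S (c u)) (lose (∈-allFin u) (from T-∧ (to (∈⇔T-lookup S) u∈S , fromWitness refl))))

  ∈-hitClusters⁻ : ∀ S {i} → i ∈ hitClusters c S → ∃ λ u → u ∈ S × c u ≡ i
  ∈-hitClusters⁻ S {i} i∈
    with satisfied (any⁻ (hitsAt S i) (allFin n) (to (∈-tabulate (λ j → any (hitsAt S j) (allFin n))) i∈))
  ... | u , hit with to T-∧ hit
  ...   | u∈S , cu≡i = u , from (∈⇔T-lookup S) u∈S , toWitness cu≡i

  hitClusters-∪ : ∀ p q → hitClusters c (p ∪ q) ≡ hitClusters c p ∪ hitClusters c q
  hitClusters-∪ p q = ⊆-antisym lhs⊆rhs rhs⊆lhs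
    where
    lhs⊆rhs : hitClusters c (p ∪ q) ⊆ hitClusters c p ∪ hitClusters c q
    lhs⊆rhs i∈ with ∈-hitClusters⁻ _ i∈
    ... | u , u∈p∪q , refl = x∈p∪q⁺ (Sum.map (∈-hitClusters⁺ p) (∈-hitClusters⁺ q) (x∈p∪q⁻ p q u∈p∪q))

    rhs⊆lhs : hitClusters c p ∪ hitClusters c q ⊆ hitClusters c (p ∪ q)
    rhs⊆lhs i∈ with x∈p∪q⁻ _ _ i∈
    ... | inj₁ i∈p with ∈-hitClusters⁻ _ i∈p
    ...   | u , u∈p , refl = ∈-hitClusters⁺ (p ∪ q) (p⊆p∪q q u∈p)
    rhs⊆lhs i∈ | inj₂ i∈q with ∈-hitClusters⁻ _ i∈q
    ...   | u , u∈q , refl = ∈-hitClusters⁺ (p ∪ q) (q⊆p∪q p q u∈q)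

  hitClusters-⁅⁆ : ∀ x → hitClusters c ⁅ x ⁆ ≡ ⁅ c x ⁆
  hitClusters-⁅⁆ x = ⊆-antisym lhs⊆rhs rhs⊆lhs
    where
    lhs⊆rhs : hitClusters c ⁅ x ⁆ ⊆ ⁅ c x ⁆
    lhs⊆rhs i∈ with ∈-hitClusters⁻ _ i∈
    ... | u , u∈⁅x⁆ , refl = from x∈⁅y⁆⇔x≡y (cong c (x∈⁅y⁆⇒x≡y x u∈⁅x⁆))

    rhs⊆lhs : ⁅ c x ⁆ ⊆ hitClusters c ⁅ x ⁆
    rhs⊆lhs i∈ =
      subst (_∈ hitClusters c ⁅ x ⁆) (sym (x∈⁅y⁆⇒x≡y (c x) i∈)) (∈-hitClusters⁺ ⁅ x ⁆ (x∈⁅x⁆ x))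

  Meets : Fin n → Subset n → Set
  Meets x S = ∃ λ u → u ∈ S × c u ≡ c x

  ∈-hitClusters⇔Meets : ∀ x S → c x ∈ hitClusters c S ⇔ Meets x S
  ∈-hitClusters⇔Meets x S =
    mk⇔ (∈-hitClusters⁻ S) λ (u , u∈S , cu≡cx) → subst (_∈ hitClusters c S) cu≡cx (∈-hitClusters⁺ S u∈S)

  count-∪⁅x⁆≡count⇔Meets : ∀ x S → count c (S ∪ ⁅ x ⁆) ≡ count c S ⇔ Meets x S
  count-∪⁅x⁆≡count⇔Meets x S =
    subst (λ H → ∣ H ∣ ≡ count c S ⇔ Meets x S)
          (sym (trans (hitClusters-∪ S ⁅ x ⁆) (cong (hitClusters c S ∪_) (hitClusters-⁅⁆ x))))
          (⇔-trans ∣p∪⁅x⁆∣≡∣p∣⇔x∈p (∈-hitClusters⇔Meets x S))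

  meets? : ∀ x S → Dec (Meets x S)
  meets? x S = Dec.map (count-∪⁅x⁆≡count⇔Meets x S) (count c (S ∪ ⁅ x ⁆) ℕ.≟ count c S)

membershipQueries : Fin n → List (Subset n) → List (Subset n)
membershipQueries x []       = []
membershipQueries x (S ∷ Ss) = S ∷ S ∪ ⁅ x ⁆ ∷ membershipQueries x Ss

readMemberships : List ℕ → List Bool
readMemberships (a ∷ a′ ∷ as) = does (a′ ℕ.≟ a) ∷ readMemberships as
readMemberships _             = []

length-membershipQueries : ∀ (x : Fin n) Ss → length (membershipQueries x Ss) ≡ 2 * length Ss
length-membershipQueries x []       = refl
length-membershipQueries x (_ ∷ Ss) =
  trans (cong (2 +_) (length-membershipQueries x Ss)) (sym (*-suc 2 (length Ss)))

readMemberships-correct : ∀ (c : Labelling n k) x Ss →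
  readMemberships (map (count c) (membershipQueries x Ss)) ≡ map (does ∘ meets? c x) Ss
readMemberships-correct c x []       = refl
readMemberships-correct c x (_ ∷ Ss) = cong (_ ∷_) (readMemberships-correct c x Ss)

record SeparatingCover (R : Subset n) (Ss : List (Subset n)) : Set where
  field
    tests⊆    : ∀ {S} → S ∈ₗ Ss → S ⊆ R
    covers    : u ∈ R → ∃ λ S → S ∈ₗ Ss × u ∈ S
    separates : u ∈ R → v ∈ R → (∀ {S} → S ∈ₗ Ss → v ∈ S → u ∈ S) → u ≡ v

ReportsSingleton : Subset n → Maybe (Fin n) → Set
ReportsSingleton p o = (∣ p ∣ ≡ 1 → ∃ λ r → o ≡ just r × r ∈ p) × (∣ p ∣ ≢ 1 → o ≡ nothing)

search-reportsSingleton : ∀ {A : Fin n → Set} (A? : Dec (∃ A)) →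
  (∀ {u} → A u → p ≡ ⁅ u ⁆) → (∀ {r} → p ≡ ⁅ r ⁆ → A r) →
  ReportsSingleton p (Maybe.map proj₁ (dec⇒maybe A?))
search-reportsSingleton (yes (u , a)) sound _ =
    (λ _ → u , refl , subst (u ∈_) (sym (sound a)) (x∈⁅x⁆ u))
  , (λ ∣p∣≢1 → contradiction (trans (cong ∣_∣ (sound a)) (∣⁅x⁆∣≡1 u)) ∣p∣≢1)
search-reportsSingleton (no ¬a) _ complete =
    (λ ∣p∣≡1 → let r , p≡⁅r⁆ = ∣p∣≡1⇒p≡⁅x⁆ ∣p∣≡1 in contradiction (r , complete p≡⁅r⁆) ¬a)
  , (λ _ → refl)

signature : List (Subset n) → Fin n → List Bool
signature Ss u = map (does ∘ (u ∈?_)) Ss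

Accepted : Subset n → List (Subset n) → List Bool → Fin n → Set
Accepted R Ss obs u = u ∈ R × signature Ss u ≡ obs

accepted? : ∀ (R : Subset n) Ss obs → Decidable (Accepted R Ss obs)
accepted? R Ss obs u = (u ∈? R) ×-dec ≡-dec Bool._≟_ (signature Ss u) obs

decode : Subset n → List (Subset n) → List Bool → Maybe (Fin n)
decode R Ss obs = Maybe.map proj₁ (dec⇒maybe (any? (accepted? R Ss obs)))

module _ (c : Labelling n k) (x : Fin n) {R : Subset n} {Ss : List (Subset n)}
         (cover : SeparatingCover R Ss) where

  open SeparatingCover cover

  Consistent : Fin n → Set
  Consistent u = ∀ {S} → S ∈ₗ Ss → u ∈ S ⇔ Meets c x S

  consistent⇒singleton : u ∈ R → Consistent u → R ∩ clusterOf c x ≡ ⁅ u ⁆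
  consistent⇒singleton {u = u} u∈R consistent = ⊆-antisym (λ v∈ → from x∈⁅y⁆⇔x≡y (≡u v∈)) ⁅u⁆⊆
    where
    ≡u : ∀ {v} → v ∈ R ∩ clusterOf c x → v ≡ u
    ≡u {v} v∈ with x∈p∩q⁻ R _ v∈
    ... | v∈R , v∈C =
      sym (separates u∈R v∈R λ S∈ v∈S → from (consistent S∈) (v , v∈S , to (∈-clusterOf c x) v∈C))

    u∈ : u ∈ R ∩ clusterOf c x
    u∈ with covers u∈R
    ... | S , S∈ , u∈S with to (consistent S∈) u∈S
    ...   | w , w∈S , cw≡cx = subst (_∈ R ∩ clusterOf c x) (≡u w∈) w∈
      where
      w∈ : w ∈ R ∩ clusterOf c x
      w∈ = x∈p∩q⁺ (tests⊆ S∈ w∈S , from (∈-clusterOf c x) cw≡cx)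

    ⁅u⁆⊆ : ⁅ u ⁆ ⊆ R ∩ clusterOf c x
    ⁅u⁆⊆ v∈⁅u⁆ = subst (_∈ R ∩ clusterOf c x) (sym (x∈⁅y⁆⇒x≡y u v∈⁅u⁆)) u∈

  singleton⇒consistent : ∀ {r} → R ∩ clusterOf c x ≡ ⁅ r ⁆ → r ∈ R × Consistent r
  singleton⇒consistent {r} R∩C≡⁅r⁆ = proj₁ r∈R×C , λ S∈ → mk⇔
      (λ r∈S → r , r∈S , to (∈-clusterOf c x) (proj₂ r∈R×C))
      (λ (w , w∈S , cw≡cx) →
         subst (_∈ _) (≡r (x∈p∩q⁺ (tests⊆ S∈ w∈S , from (∈-clusterOf c x) cw≡cx))) w∈S)
    where
    r∈R×C : r ∈ R × r ∈ clusterOf c x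
    r∈R×C = x∈p∩q⁻ R _ (subst (r ∈_) (sym R∩C≡⁅r⁆) (x∈⁅x⁆ r))

    ≡r : ∀ {w} → w ∈ R ∩ clusterOf c x → w ≡ r
    ≡r w∈ = x∈⁅y⁆⇒x≡y r (subst (_ ∈_) R∩C≡⁅r⁆ w∈)

  decode-reportsSingleton : ∀ {obs} → obs ≡ map (does ∘ meets? c x) Ss →
    ReportsSingleton (R ∩ clusterOf c x) (decode R Ss obs)
  decode-reportsSingleton refl = search-reportsSingleton (any? (accepted? R Ss _)) sound complete
    where
    sound : ∀ {u} → Accepted R Ss (map (does ∘ meets? c x) Ss) u → R ∩ clusterOf c x ≡ ⁅ u ⁆
    sound {u} (u∈R , sig≡) = consistent⇒singleton u∈R (to (map-does-≡⇔ (u ∈?_) (meets? c x) Ss) sig≡)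

    complete : ∀ {r} → R ∩ clusterOf c x ≡ ⁅ r ⁆ → Accepted R Ss (map (does ∘ meets? c x) Ss) r
    complete {r} R∩C≡⁅r⁆ with singleton⇒consistent R∩C≡⁅r⁆
    ... | r∈R , consistent = r∈R , from (map-does-≡⇔ (r ∈?_) (meets? c x) Ss) consistent

rank : Subset n → Fin n → ℕ
rank (_       ∷ p) 0F          = 0
rank (inside  ∷ p) (Fin.suc u) = suc (rank p u)
rank (outside ∷ p) (Fin.suc u) = rank p u

rank<∣p∣ : u ∈ p → rank p u < ∣ p ∣
rank<∣p∣                   Vec.here        = s≤s z≤n
rank<∣p∣ {p = inside  ∷ p} (Vec.there u∈p) = s≤s (rank<∣p∣ u∈p)
rank<∣p∣ {p = outside ∷ p} (Vec.there u∈p) = rank<∣p∣ u∈p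

rank-injective : u ∈ p → v ∈ p → rank p u ≡ rank p v → u ≡ v
rank-injective                   Vec.here        Vec.here        _  = refl
rank-injective {p = inside  ∷ p} (Vec.there u∈p) (Vec.there v∈p) eq =
  cong Fin.suc (rank-injective u∈p v∈p (suc-injective eq))
rank-injective {p = outside ∷ p} (Vec.there u∈p) (Vec.there v∈p) eq =
  cong Fin.suc (rank-injective u∈p v∈p eq)

digits : ∀ d .{{_ : NonZero d}} b → ℕ → Vec (Fin d) b
digits d zero    m = []
digits d (suc b) m = m mod d ∷ digits d b (m / d)

digits-injective : ∀ d .{{_ : NonZero d}} b {m m′} → m < d ^ b → m′ < d ^ b →
                   lookup (digits d b m) ≗ lookup (digits d b m′) → m ≡ m′
digits-injective d zero    (s≤s z≤n) (s≤s z≤n) _ = refl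
digits-injective d (suc b) {m} {m′} m< m′< same = begin
  m                   ≡⟨ m≡m%n+[m/n]*n m d ⟩
  m % d + m / d * d   ≡⟨ cong₂ (λ r q → r + q * d) lowest rest ⟩
  m′ % d + m′ / d * d ≡⟨ sym (m≡m%n+[m/n]*n m′ d) ⟩
  m′                  ∎
  where
  open ≡-Reasoning
  lowest : m % d ≡ m′ % d
  lowest = trans (sym (toℕ-fromℕ< (m%n<n m d))) (trans (cong toℕ (same 0F)) (toℕ-fromℕ< (m%n<n m′ d)))
  quotient< : ∀ {l} → l < d ^ suc b → l / d < d ^ b
  quotient< {l} l< = m<n*o⇒m/o<n (subst (l <_) (*-comm d (d ^ b)) l<)
  rest : m / d ≡ m′ / d
  rest = digits-injective d b (quotient< m<) (quotient< m′<) (same ∘ Fin.suc)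

n≤2^⌈log₂n⌉ : ∀ n → n ≤ 2 ^ ⌈log₂ n ⌉
n≤2^⌈log₂n⌉ n = bound n (<-wellFounded n)
  where
  n≤2*⌈n/2⌉ : ∀ n → n ≤ 2 * ⌈ n /2⌉
  n≤2*⌈n/2⌉ n = begin
    n                     ≡⟨ sym (⌊n/2⌋+⌈n/2⌉≡n n) ⟩
    ⌊ n /2⌋ + ⌈ n /2⌉     ≤⟨ +-monoˡ-≤ ⌈ n /2⌉ (⌊n/2⌋≤⌈n/2⌉ n) ⟩
    ⌈ n /2⌉ + ⌈ n /2⌉     ≡⟨ cong (⌈ n /2⌉ +_) (sym (+-identityʳ ⌈ n /2⌉)) ⟩
    2 * ⌈ n /2⌉           ∎
    where open ≤-Reasoning

  bound : ∀ n (rec : Acc _<_ n) → n ≤ 2 ^ ⌈log2⌉ n rec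
  bound 0             _        = z≤n
  bound 1             _        = ≤-refl
  bound (suc (suc n)) (acc rs) =
    ≤-trans (n≤2*⌈n/2⌉ (suc (suc n))) (*-monoʳ-≤ 2 (bound (suc ⌈ n /2⌉) (rs (⌈n/2⌉<n n))))

binaryCode : (R : Subset n) → Fin n → Vec (Fin 2) ⌈log₂ ∣ R ∣ ⌉
binaryCode R u = digits 2 ⌈log₂ ∣ R ∣ ⌉ (rank R u)

binaryCode-injective : u ∈ R → v ∈ R → lookup (binaryCode R u) ≗ lookup (binaryCode R v) → u ≡ v
binaryCode-injective {R = R} u∈R v∈R same =
  rank-injective u∈R v∈R (digits-injective 2 ⌈log₂ ∣ R ∣ ⌉ (rank< u∈R) (rank< v∈R) same)
  where
  rank< : ∀ {u} → u ∈ R → rank R u < 2 ^ ⌈log₂ ∣ R ∣ ⌉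
  rank< u∈R = <-≤-trans (rank<∣p∣ u∈R) (n≤2^⌈log₂n⌉ ∣ R ∣)

module _ (R : Subset n) (code : Fin n → Vec (Fin 2) b) where

  fibre : Fin b → Fin 2 → Subset n
  fibre j β = R ∩ tabulate (λ u → ⌊ lookup (code u) j ≟ β ⌋)

  ∈-fibre : ∀ {j β} → u ∈ fibre j β ⇔ (u ∈ R × lookup (code u) j ≡ β)
  ∈-fibre = mk⇔
    (λ u∈ → let u∈R , u∈≟ = x∈p∩q⁻ R _ u∈ in u∈R , toWitness (to (∈-tabulate _) u∈≟))
    (λ (u∈R , bit≡β) → x∈p∩q⁺ (u∈R , from (∈-tabulate _) (fromWitness bit≡β)))

  bitFibres : List (Fin b) → List (Subset n)
  bitFibres []       = []
  bitFibres (j ∷ js) = fibre j 0F ∷ fibre j 1F ∷ bitFibres js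

  length-bitFibres : ∀ js → length (bitFibres js) ≡ 2 * length js
  length-bitFibres []       = refl
  length-bitFibres (_ ∷ js) = trans (cong (2 +_) (length-bitFibres js)) (sym (*-suc 2 (length js)))

  fibre∈bitFibres : ∀ {j js} → j ∈ₗ js → ∀ β → fibre j β ∈ₗ bitFibres js
  fibre∈bitFibres (here refl) 0F = here refl
  fibre∈bitFibres (here refl) 1F = there (here refl)
  fibre∈bitFibres (there j∈)  β  = there (there (fibre∈bitFibres j∈ β))

  bitFibres⊆ : ∀ js {S} → S ∈ₗ bitFibres js → S ⊆ R
  bitFibres⊆ (_ ∷ _)  (here refl)         = p∩q⊆p R _
  bitFibres⊆ (_ ∷ _)  (there (here refl)) = p∩q⊆p R _
  bitFibres⊆ (_ ∷ js) (there (there S∈))  = bitFibres⊆ js S∈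

  bitFibres-separatingCover : (∀ {u v} → u ∈ R → v ∈ R → lookup (code u) ≗ lookup (code v) → u ≡ v) →
                              Fin b → SeparatingCover R (bitFibres (allFin b))
  bitFibres-separatingCover code-injective j₀ = record
    { tests⊆    = bitFibres⊆ (allFin b)
    ; covers    = λ {u} u∈R →
        fibre j₀ (lookup (code u) j₀) , fibre∈bitFibres (∈-allFin j₀) _ , from ∈-fibre (u∈R , refl)
    ; separates = λ {u} {v} u∈R v∈R v∈⇒u∈ → code-injective u∈R v∈R λ j →
        proj₂ (to ∈-fibre (v∈⇒u∈ (fibre∈bitFibres (∈-allFin j) _) (from ∈-fibre (v∈R , refl))))
    }

binaryTests : Subset n → List (Subset n)
binaryTests R = bitFibres R (binaryCode R) (allFin ⌈log₂ ∣ R ∣ ⌉)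

-- With ∣ R ∣ = 1 the code would be empty, nothing would be queried, and the point of R would be
-- reported whether or not it lies in C(x); a positive code length is what makes the fibres cover R.
binaryTests-separatingCover : 2 ≤ ∣ R ∣ → SeparatingCover R (binaryTests R)
binaryTests-separatingCover {R = R} 2≤∣R∣ =
  bitFibres-separatingCover R (binaryCode R) binaryCode-injective (fromℕ< (⌈log₂⌉-mono-≤ 2≤∣R∣))

findRep : (n : ℕ) → NonAdaptiveAlg n
findRep n = record
  { queries = λ x R → membershipQueries x (binaryTests R)
  ; decide  = λ _ R answers → decode R (binaryTests R) (readMemberships answers)
  }

length-findRep-queries : ∀ x (R : Subset n) → length (queries (findRep n) x R) ≡ 4 * ⌈log₂ ∣ R ∣ ⌉
length-findRep-queries x R = begin
  length (membershipQueries x (binaryTests R)) ≡⟨ length-membershipQueries x (binaryTests R) ⟩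
  2 * length (binaryTests R)                   ≡⟨ cong (2 *_) (length-bitFibres R (binaryCode R) (allFin m)) ⟩
  2 * (2 * length (allFin m))                  ≡⟨ cong (λ l → 2 * (2 * l)) (length-tabulate {n = m} id) ⟩
  2 * (2 * m)                                  ≡⟨ sym (*-assoc 2 2 m) ⟩
  4 * m                                        ∎
  where
  open ≡-Reasoning
  m : ℕ
  m = ⌈log₂ ∣ R ∣ ⌉

corollary1p12 : (n k : ℕ) → Σ (NonAdaptiveAlg n) (λ A →
    (x : Fin n) (R : Subset n) → 2 ≤ ∣ R ∣ →
      (length (queries A x R) ≡ 4 * ⌈log₂ ∣ R ∣ ⌉)
      × ((c : Labelling n k) → IsClustering c → FindRepCorrect A c x R))
corollary1p12 n k = findRep n , λ x R 2≤∣R∣ →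
    length-findRep-queries x R
  , λ c _ → decode-reportsSingleton c x (binaryTests-separatingCover 2≤∣R∣)
                                        (readMemberships-correct c x (binaryTests R))
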